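{- Let $j\in\mathbb{N}$. For any multiformula $\mho$, there is a logically equivalent multiformula $\mho'$ such that $j$ is $\bar\wedge\bar\vee$-separated (respectively, $\bar\vee\bar\wedge$-separated) in $\mho'$.
   Context: Multiformulas (over a modal language) are generated by $\mho ::= i:\phi \mid (\mho \,\bar\vee\, \mho) \mid (\mho \,\bar\wedge\, \mho)$ with $\phi$ a formula and $i\in\mathbb{N}$ a label; $\bar\vee$ and $\bar\wedge$ denote multiformula disjunction and conjunction. Given a Kripke model $\mathcal{M}$ and a map $[\cdot]$ from labels (including those of $\mho$) to worlds, $i:\phi$ holds iff $\mathcal{M},[i]\models\phi$, and $\bar\wedge,\bar\vee$ behave classically. Two multiformulas are logically equivalent iff they hold under exactly the same models and interpretations. A label $j$ is $\bar\wedge\bar\vee$-separated (resp. $\bar\vee\bar\wedge$-separated) in $\mho$ iff for some formulas $B_1,\dots,B_m$ and multiformulas $\mho_1,\dots,\mho_m$ not containing label $j$, $\mho$ is the multiformula conjunction over $k=1,\dots,m$ of $(j:B_k \,\bar\vee\, \mho_k)$ (resp. the multiformula disjunction over $k$ of $(j:B_k \,\bar\wedge\, \mho_k)$). -}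

module Defs where

open import Data.Nat using (ℕ)
open import Data.Product using (_×_; _,_; Σ; Σ-syntax)
open import Data.Sum using (_⊎_)
open import Data.Empty using (⊥)
open import Data.Unit using (⊤)
open import Data.List using (List; []; _∷_)
open import Data.List.Relation.Unary.All using (All)
open import Relation.Nullary using (¬_)
open import Relation.Binary.PropositionalEquality using (_≡_; _≢_)
open import Function.Bundles using (_⇔_)
open import Level using (0ℓ)

data Formula : Set where
  var  : ℕ → Formula
  ⊥'   : Formula
  ⊤'   : Formula
  ¬'_  : Formula → Formula
  _∧'_ : Formula → Formula → Formula
  _∨'_ : Formula → Formula → Formula
  _⇒'_ : Formula → Formula → Formula
  □_   : Formula → Formula
  ◇_   : Formula → Formula

record Model : Set₁ where
  field
    World : Set
    R     : World → World → Set
    V     : ℕ → World → Set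
open Model public

_,_⊨_ : (M : Model) → World M → Formula → Set
M , w ⊨ var p   = V M p w
M , w ⊨ ⊥'      = ⊥
M , w ⊨ ⊤'      = ⊤
M , w ⊨ (¬' φ)  = ¬ (M , w ⊨ φ)
M , w ⊨ (φ ∧' ψ) = (M , w ⊨ φ) × (M , w ⊨ ψ)
M , w ⊨ (φ ∨' ψ) = (M , w ⊨ φ) ⊎ (M , w ⊨ ψ)
M , w ⊨ (φ ⇒' ψ) = (M , w ⊨ φ) → (M , w ⊨ ψ)
M , w ⊨ (□ φ)   = ∀ v → R M w v → M , v ⊨ φ
M , w ⊨ (◇ φ)   = Σ[ v ∈ World M ] (R M w v × (M , v ⊨ φ))

infixr 5 _∨̄_
infixr 6 _∧̄_
data Multi : Set where
  _∶_ : ℕ → Formula → Multi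
  _∨̄_ : Multi → Multi → Multi
  _∧̄_ : Multi → Multi → Multi

Holds : (M : Model) → (ℕ → World M) → Multi → Set
Holds M I (i ∶ φ)  = M , I i ⊨ φ
Holds M I (μ ∨̄ ν) = Holds M I μ ⊎ Holds M I ν
Holds M I (μ ∧̄ ν) = Holds M I μ × Holds M I ν

_≋_ : Multi → Multi → Set₁
μ ≋ ν = (M : Model) (I : ℕ → World M) → _⇔_ {0ℓ} {0ℓ} (Holds M I μ) (Holds M I ν)

LabelFree : ℕ → Multi → Set
LabelFree j (i ∶ φ)  = i ≢ j
LabelFree j (μ ∨̄ ν) = LabelFree j μ × LabelFree j ν
LabelFree j (μ ∧̄ ν) = LabelFree j μ × LabelFree j ν

BigConj : (Formula × Multi → Multi) → Formula × Multi → List (Formula × Multi) → Multi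
BigConj f x []       = f x
BigConj f x (y ∷ ys) = f x ∧̄ BigConj f y ys

BigDisj : (Formula × Multi → Multi) → Formula × Multi → List (Formula × Multi) → Multi
BigDisj f x []       = f x
BigDisj f x (y ∷ ys) = f x ∨̄ BigDisj f y ys

FreeOf : ℕ → Formula × Multi → Set
FreeOf j (B , ν) = LabelFree j ν

ConjDisjSeparated : ℕ → Multi → Set
ConjDisjSeparated j μ =
  Σ[ x ∈ Formula × Multi ] Σ[ xs ∈ List (Formula × Multi) ]
    (FreeOf j x × All (FreeOf j) xs ×
     μ ≡ BigConj (λ { (B , ν) → (j ∶ B) ∨̄ ν }) x xs)

DisjConjSeparated : ℕ → Multi → Set
DisjConjSeparated j μ =
  Σ[ x ∈ Formula × Multi ] Σ[ xs ∈ List (Formula × Multi) ]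
    (FreeOf j x × All (FreeOf j) xs ×
     μ ≡ BigDisj (λ { (B , ν) → (j ∶ B) ∧̄ ν }) x xs)

{-# OPTIONS --safe #-}
-- Bring μ into conjunctive normal form over clauses (B , ν), read as j:B ∨̄ ν with ν
-- free of j: the atom j:φ is the clause (φ , ⊥), any other atom i:φ the clause (⊥ , i:φ);
-- conjunction concatenates clause lists, and disjunction takes all pairwise clause
-- disjunctions, since (j:B ∨̄ ν) ∨̄ (j:C ∨̄ ρ) ≋ j:(B ∨ C) ∨̄ (ν ∨̄ ρ).
-- The ∨̄∧̄ case is the dual disjunctive normal form.
module Submission where

open import Defs
open import Data.Nat using (ℕ; suc; _≟_)
open import Data.Nat.Properties using (1+n≢n)
open import Data.Product using (_×_; Σ-syntax; _,_; proj₁; proj₂; uncurry)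
open import Data.Product.Function.NonDependent.Propositional using (_×-⇔_)
open import Data.Sum using (_⊎_; inj₁; inj₂; [_,_]′)
import Data.Sum as Sum
open import Data.Sum.Function.Propositional using (_⊎-⇔_)
open import Data.Unit using (tt)
open import Data.List using (List; []; _∷_; [_]; _++_; map; cartesianProductWith)
open import Data.List.Relation.Unary.All as All using (All; []; _∷_)
import Data.List.Relation.Unary.All.Properties as All
open import Data.List.Relation.Unary.Any using (Any)
import Data.List.Relation.Unary.Any.Properties as Any
open import Function using (_∘_; id)
open import Function.Bundles using (_⇔_; mk⇔; Equivalence)
import Function.Properties.Equivalence as ⇔
open import Function.Properties.Inverse using (↔⇒⇔)
open import Relation.Nullary using (yes; no; contradiction)
open import Relation.Unary using (Pred)
open import Relation.Binary.PropositionalEquality using (refl)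
open import Relation.Binary.PropositionalEquality.Properties using (setoid)

module _ {a b c p q r} {A : Set a} {B : Set b} {C : Set c}
         {P : Pred A p} {Q : Pred B q} {R : Pred C r} (f : A → B → C) where

  private
    pull : ∀ {x} {ys} → All (λ y → P x ⊎ Q y) ys → P x ⊎ All Q ys
    pull []              = inj₂ []
    pull (inj₁ px ∷ _)   = inj₁ px
    pull (inj₂ qy ∷ pys) = Sum.map₂ (qy ∷_) (pull pys)

  All-cartesianProductWith⁻ : (∀ {x y} → R (f x y) → P x ⊎ Q y) →
                              ∀ xs ys → All R (cartesianProductWith f xs ys) →
                              All P xs ⊎ All Q ys
  All-cartesianProductWith⁻ split []       ys _   = inj₁ []
  All-cartesianProductWith⁻ split (x ∷ xs) ys rs
    with All.++⁻ (map (f x) ys) rs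
  ... | rxys , rxsys with pull (All.map split (All.map⁻ rxys))
  ...   | inj₁ px  = Sum.map₁ (px ∷_) (All-cartesianProductWith⁻ split xs ys rxsys)
  ...   | inj₂ qys = inj₂ qys

  All-cartesianProductWith⁺ : (∀ {x y} → P x → Q y → R (f x y)) →
                              ∀ {xs ys} → All P xs → All Q ys →
                              All R (cartesianProductWith f xs ys)
  All-cartesianProductWith⁺ pres {xs} {ys} pxs qys =
    All.cartesianProductWith⁺ (setoid A) (setoid B) f xs ys
      (λ x∈ y∈ → pres (All.lookup pxs x∈) (All.lookup qys y∈))

  All-cartesianProductWith⇔ : (∀ {x y} → R (f x y) ⇔ (P x ⊎ Q y)) →
                              ∀ {xs ys} → All R (cartesianProductWith f xs ys)
                                          ⇔ (All P xs ⊎ All Q ys)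
  All-cartesianProductWith⇔ R⇔ {xs} {ys} = mk⇔
    (All-cartesianProductWith⁻ (Equivalence.to R⇔) xs ys)
    [ (λ pxs → All.cartesianProductWith⁺ (setoid A) (setoid B) f xs ys
                 (λ x∈ _ → Equivalence.from R⇔ (inj₁ (All.lookup pxs x∈))))
    , (λ qys → All.cartesianProductWith⁺ (setoid A) (setoid B) f xs ys
                 (λ _ y∈ → Equivalence.from R⇔ (inj₂ (All.lookup qys y∈))))
    ]′

  Any-cartesianProductWith⇔ : (∀ {x y} → R (f x y) ⇔ (P x × Q y)) →
                              ∀ {xs ys} → Any R (cartesianProductWith f xs ys)
                                          ⇔ (Any P xs × Any Q ys)
  Any-cartesianProductWith⇔ R⇔ {xs} {ys} = mk⇔
    (Any.cartesianProductWith⁻ f (Equivalence.to R⇔) xs ys)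
    (uncurry (Any.cartesianProductWith⁺ f (λ px qy → Equivalence.from R⇔ (px , qy))))

module _ {a b c d} {A : Set a} {B : Set b} {C : Set c} {D : Set d} where

  ⊎-medial : (A ⊎ B) ⊎ (C ⊎ D) → (A ⊎ C) ⊎ (B ⊎ D)
  ⊎-medial (inj₁ (inj₁ x)) = inj₁ (inj₁ x)
  ⊎-medial (inj₁ (inj₂ y)) = inj₂ (inj₁ y)
  ⊎-medial (inj₂ (inj₁ z)) = inj₁ (inj₂ z)
  ⊎-medial (inj₂ (inj₂ w)) = inj₂ (inj₂ w)

  ×-medial : (A × B) × (C × D) → (A × C) × (B × D)
  ×-medial ((x , y) , (z , w)) = (x , z) , (y , w)

Clause : Set
Clause = Formula × Multi

∨-clause ∧-clause : ℕ → Clause → Multi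
∨-clause j (B , ν) = (j ∶ B) ∨̄ ν
∧-clause j (B , ν) = (j ∶ B) ∧̄ ν

_∨ᶜ_ _∧ᶜ_ : Clause → Clause → Clause
(B , ν) ∨ᶜ (C , ρ) = B ∨' C , ν ∨̄ ρ
(B , ν) ∧ᶜ (C , ρ) = B ∧' C , ν ∧̄ ρ

-- Label suc j merely serves as some label different from j.
⊥̄ ⊤̄ : ℕ → Multi
⊥̄ j = suc j ∶ ⊥'
⊤̄ j = suc j ∶ ⊤'

cnf dnf : ℕ → Multi → List Clause
cnf j (i ∶ φ) with i ≟ j
... | yes _ = [ φ , ⊥̄ j ]
... | no _  = [ ⊥' , i ∶ φ ]
cnf j (μ ∧̄ ν) = cnf j μ ++ cnf j ν
cnf j (μ ∨̄ ν) = cartesianProductWith _∨ᶜ_ (cnf j μ) (cnf j ν)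

dnf j (i ∶ φ) with i ≟ j
... | yes _ = [ φ , ⊤̄ j ]
... | no _  = [ ⊤' , i ∶ φ ]
dnf j (μ ∨̄ ν) = dnf j μ ++ dnf j ν
dnf j (μ ∧̄ ν) = cartesianProductWith _∧ᶜ_ (dnf j μ) (dnf j ν)

cnf-labelFree : ∀ j μ → All (FreeOf j) (cnf j μ)
cnf-labelFree j (i ∶ φ) with i ≟ j
... | yes _  = 1+n≢n ∷ []
... | no i≢j = i≢j ∷ []
cnf-labelFree j (μ ∧̄ ν) = All.++⁺ (cnf-labelFree j μ) (cnf-labelFree j ν)
cnf-labelFree j (μ ∨̄ ν) =
  All-cartesianProductWith⁺ _∨ᶜ_ _,_ (cnf-labelFree j μ) (cnf-labelFree j ν)

dnf-labelFree : ∀ j μ → All (FreeOf j) (dnf j μ)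
dnf-labelFree j (i ∶ φ) with i ≟ j
... | yes _  = 1+n≢n ∷ []
... | no i≢j = i≢j ∷ []
dnf-labelFree j (μ ∨̄ ν) = All.++⁺ (dnf-labelFree j μ) (dnf-labelFree j ν)
dnf-labelFree j (μ ∧̄ ν) =
  All-cartesianProductWith⁺ _∧ᶜ_ _,_ (dnf-labelFree j μ) (dnf-labelFree j ν)

module _ (M : Model) (I : ℕ → World M) where

  Holds-BigConj : ∀ f x xs → Holds M I (BigConj f x xs) ⇔ All (Holds M I ∘ f) (x ∷ xs)
  Holds-BigConj f x []       = mk⇔ (_∷ []) All.singleton⁻
  Holds-BigConj f x (y ∷ ys) =
    ⇔.trans (⇔.refl ×-⇔ Holds-BigConj f y ys) (mk⇔ (uncurry _∷_) All.uncons)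

  Holds-BigDisj : ∀ f x xs → Holds M I (BigDisj f x xs) ⇔ Any (Holds M I ∘ f) (x ∷ xs)
  Holds-BigDisj f x []       = mk⇔ Any.singleton⁺ Any.singleton⁻
  Holds-BigDisj f x (y ∷ ys) =
    ⇔.trans (⇔.refl ⊎-⇔ Holds-BigDisj f y ys) (↔⇒⇔ (Any.∷↔ _))

  module _ (j : ℕ) where

    ∨-clause-∨ᶜ : ∀ {c d} → Holds M I (∨-clause j (c ∨ᶜ d))
                          ⇔ (Holds M I (∨-clause j c) ⊎ Holds M I (∨-clause j d))
    ∨-clause-∨ᶜ = mk⇔ ⊎-medial ⊎-medial

    ∧-clause-∧ᶜ : ∀ {c d} → Holds M I (∧-clause j (c ∧ᶜ d))
                          ⇔ (Holds M I (∧-clause j c) × Holds M I (∧-clause j d))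
    ∧-clause-∧ᶜ = mk⇔ ×-medial ×-medial

    cnf-correct : ∀ μ → Holds M I μ ⇔ All (Holds M I ∘ ∨-clause j) (cnf j μ)
    cnf-correct (i ∶ φ) with i ≟ j
    ... | yes refl = mk⇔ (λ h → inj₁ h ∷ []) ([ id , (λ ()) ]′ ∘ All.singleton⁻)
    ... | no _     = mk⇔ (λ h → inj₂ h ∷ []) ([ (λ ()) , id ]′ ∘ All.singleton⁻)
    cnf-correct (μ ∧̄ ν) = ⇔.trans (cnf-correct μ ×-⇔ cnf-correct ν) (↔⇒⇔ All.++↔)
    cnf-correct (μ ∨̄ ν) =
      ⇔.trans (cnf-correct μ ⊎-⇔ cnf-correct ν)
              (⇔.sym (All-cartesianProductWith⇔ _∨ᶜ_ (λ {c d} → ∨-clause-∨ᶜ {c} {d})))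

    dnf-correct : ∀ μ → Holds M I μ ⇔ Any (Holds M I ∘ ∧-clause j) (dnf j μ)
    dnf-correct (i ∶ φ) with i ≟ j
    ... | yes refl = mk⇔ (λ h → Any.singleton⁺ (h , tt)) (proj₁ ∘ Any.singleton⁻)
    ... | no _     = mk⇔ (λ h → Any.singleton⁺ (tt , h)) (proj₂ ∘ Any.singleton⁻)
    dnf-correct (μ ∨̄ ν) = ⇔.trans (dnf-correct μ ⊎-⇔ dnf-correct ν) (↔⇒⇔ Any.++↔)
    dnf-correct (μ ∧̄ ν) =
      ⇔.trans (dnf-correct μ ×-⇔ dnf-correct ν)
              (⇔.sym (Any-cartesianProductWith⇔ _∧ᶜ_ (λ {c d} → ∧-clause-∧ᶜ {c} {d})))

ConjDisjSeparated-from-clauses : ∀ j μ (L : List Clause) → All (FreeOf j) L →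
  (∀ M I → Holds M I μ ⇔ All (Holds M I ∘ ∨-clause j) L) →
  Σ[ μ' ∈ Multi ] (μ ≋ μ' × ConjDisjSeparated j μ')
ConjDisjSeparated-from-clauses j μ [] [] μ⇔ =
  ∨-clause j (⊤' , ⊥̄ j) ,
  (λ M I → mk⇔ (λ _ → inj₁ tt) (λ _ → Equivalence.from (μ⇔ M I) [])) ,
  ((⊤' , ⊥̄ j) , [] , 1+n≢n , [] , refl)
ConjDisjSeparated-from-clauses j μ (x ∷ xs) (fx ∷ fxs) μ⇔ =
  BigConj (∨-clause j) x xs ,
  (λ M I → ⇔.trans (μ⇔ M I) (⇔.sym (Holds-BigConj M I (∨-clause j) x xs))) ,
  (x , xs , fx , fxs , refl)

DisjConjSeparated-from-clauses : ∀ j μ (L : List Clause) → All (FreeOf j) L →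
  (∀ M I → Holds M I μ ⇔ Any (Holds M I ∘ ∧-clause j) L) →
  Σ[ μ' ∈ Multi ] (μ ≋ μ' × DisjConjSeparated j μ')
DisjConjSeparated-from-clauses j μ [] [] μ⇔ =
  ∧-clause j (⊥' , ⊤̄ j) ,
  (λ M I → mk⇔ (λ h → contradiction (Equivalence.to (μ⇔ M I) h) λ ()) (λ ())) ,
  ((⊥' , ⊤̄ j) , [] , 1+n≢n , [] , refl)
DisjConjSeparated-from-clauses j μ (x ∷ xs) (fx ∷ fxs) μ⇔ =
  BigDisj (∧-clause j) x xs ,
  (λ M I → ⇔.trans (μ⇔ M I) (⇔.sym (Holds-BigDisj M I (∧-clause j) x xs))) ,
  (x , xs , fx , fxs , refl)

proposition5p19 : (j : ℕ) (μ : Multi) →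
    (Σ[ μ' ∈ Multi ] (μ ≋ μ' × ConjDisjSeparated j μ'))
    × (Σ[ μ' ∈ Multi ] (μ ≋ μ' × DisjConjSeparated j μ'))
proposition5p19 j μ =
    ConjDisjSeparated-from-clauses j μ (cnf j μ) (cnf-labelFree j μ) (λ M I → cnf-correct M I j μ)
  , DisjConjSeparated-from-clauses j μ (dnf j μ) (dnf-labelFree j μ) (λ M I → dnf-correct M I j μ)
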